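{- Let $G$ be an outerplanar near triangulation with outer cycle $C$, let $u,v\in V(C)$ with $uv\in E(C)$, let $\mathcal{H}=(L,H)$ be a $2$-fold correspondence cover of $G$, and let $\phi$ be a partial $3$-defective $\mathcal{H}$-coloring of $G$ with domain $\{u,v\}$. Then $\phi$ can be extended to a $3$-defective $\mathcal{H}$-coloring $\psi$ of $G$ such that: (1) if $\phi(u)$ and $\phi(v)$ are adjacent in $H$, then $\mathrm{def}_\psi(u)\le 1$ and $\mathrm{def}_\psi(v)\le 2$; (2) if $\phi(u)$ and $\phi(v)$ are not adjacent in $H$, then $\mathrm{def}_\psi(u)=0$ and $\mathrm{def}_\psi(v)\le 1$.
   Context: All graphs are finite, simple and undirected. An outerplanar near triangulation is an outerplanar graph embedded with all vertices on the outer face, bounded by the outer cycle $C$, in which every interior face is a triangle. A correspondence cover of $G$ is a pair $\mathcal{H}=(L,H)$ where $H$ is a graph and $L:V(G)\to 2^{V(H)}$ satisfies: (1) $\{L(v)\}$ partitions $V(H)$; (2) each $L(v)$ is independent in $H$; (3) for all $u,v$, the edges of $H[L(u)\cup L(v)]$ form a matching, empty if $uv\notin E(G)$. It is $2$-fold if $|L(v)|\ge 2$ for all $v$. A (partial) $\mathcal{H}$-coloring is a (partial) map $\phi$ with $\phi(w)\in L(w)$ wherever defined. For an $\mathcal{H}$-coloring $\psi$, $\mathrm{def}_\psi(w)$ is the number of neighbors $w'$ of $w$ in $G$ with $\psi(w')$ adjacent to $\psi(w)$ in $H$; $\psi$ is $3$-defective if $\mathrm{def}_\psi(w)\le 3$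 for all $w$ (for a partial coloring, counting only colored neighbors). -}

module Defs where

open import Data.Nat using (ℕ; zero; suc; _+_; _∸_; _≤_; _<_; _⊓_; _⊔_)
open import Data.Fin using (Fin; toℕ)
open import Data.Bool using (Bool; true; false; _∧_; if_then_else_)
open import Data.Maybe using (Maybe; just; nothing)
open import Data.List using (List; map; allFin)
open import Data.Nat.ListAction using (sum)
open import Data.Product using (Σ; ∃; _×_; _,_)
open import Data.Sum using (_⊎_)
open import Relation.Binary.PropositionalEquality using (_≡_; _≢_)
open import Relation.Nullary using (¬_)

record Graph (n : ℕ) : Set where
  field
    adj   : Fin n → Fin n → Bool
    sym   : ∀ x y → adj x y ≡ adj y x
    irefl : ∀ x → adj x x ≡ false
open Graph public

-- Outer cycle convention: the outer cycle C is 0,1,...,n-1,0.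

CycleAdj : {n : ℕ} → Fin n → Fin n → Set
CycleAdj {n} i j = (toℕ j ≡ suc (toℕ i)) ⊎ ((toℕ i ≡ n ∸ 1) × (toℕ j ≡ 0))

OnCycleEdge : {n : ℕ} → Fin n → Fin n → Set
OnCycleEdge u v = CycleAdj u v ⊎ CycleAdj v u

-- two chords {a,b} and {c,d} of the convex polygon 0..n-1 cross
Cross : {n : ℕ} → Fin n → Fin n → Fin n → Fin n → Set
Cross a b c d =
  let l₁ = toℕ a ⊓ toℕ b ; h₁ = toℕ a ⊔ toℕ b
      l₂ = toℕ c ⊓ toℕ d ; h₂ = toℕ c ⊔ toℕ d
  in (l₁ < l₂ × l₂ < h₁ × h₁ < h₂) ⊎ (l₂ < l₁ × l₁ < h₂ × h₂ < h₁)

-- G is an outerplanar near triangulation with outer cycle 0,1,...,n-1: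
--  * n ≥ 3 and all edges of C are edges of G;
--  * (outerplanar embedding, all vertices on C) no two edges cross when
--    drawn as straight chords of the convex polygon 0..n-1;
--  * (every interior face is a triangle) no further chord can be added
--    without crossing, i.e. every non-adjacent pair of distinct vertices
--    is separated by a crossing edge.
record OuterplanarNearTriangulation {n : ℕ} (G : Graph n) : Set where
  field
    three     : 3 ≤ n
    cycle     : ∀ i j → CycleAdj i j → adj G i j ≡ true
    noCross   : ∀ a b c d → adj G a b ≡ true → adj G c d ≡ true → ¬ Cross a b c d
    triangles : ∀ a b → a ≢ b → adj G a b ≡ false →
                ∃ λ c → ∃ λ d → adj G c d ≡ true × Cross a b c d

-- Correspondence covers. L(x) ≅ Fin (size x); the cover graph H is given
-- by match x y a b = "the vertex a ∈ L(x) is adjacent in H to b ∈ L(y)".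

record Cover {n : ℕ} (G : Graph n) : Set where
  field
    size    : Fin n → ℕ
    match   : (x y : Fin n) → Fin (size x) → Fin (size y) → Bool
    msym    : ∀ x y a b → match x y a b ≡ match y x b a
    -- edges only between L(x), L(y) with xy ∈ E(G) (in particular each L(x) independent)
    mnonadj : ∀ x y a b → adj G x y ≡ false → match x y a b ≡ false
    mmatch  : ∀ x y a b b' → match x y a b ≡ true → match x y a b' ≡ true → b ≡ b'
open Cover public

TwoFold : {n : ℕ} {G : Graph n} → Cover G → Set
TwoFold {n} 𝓗 = ∀ (x : Fin n) → 2 ≤ size 𝓗 x

Coloring : {n : ℕ} {G : Graph n} → Cover G → Set
Coloring {n} 𝓗 = (x : Fin n) → Fin (size 𝓗 x)

PartialColoring : {n : ℕ} {G : Graph n} → Cover G → Set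
PartialColoring {n} 𝓗 = (x : Fin n) → Maybe (Fin (size 𝓗 x))

def : {n : ℕ} {G : Graph n} (𝓗 : Cover G) → Coloring 𝓗 → Fin n → ℕ
def {n} {G} 𝓗 ψ w =
  sum (map (λ x → if adj G w x ∧ match 𝓗 w x (ψ w) (ψ x) then 1 else 0) (allFin n))

bothAdj : {n : ℕ} {G : Graph n} (𝓗 : Cover G) (w x : Fin n) →
          Maybe (Fin (size 𝓗 w)) → Maybe (Fin (size 𝓗 x)) → Bool
bothAdj 𝓗 w x (just a) (just b) = match 𝓗 w x a b
bothAdj 𝓗 w x _ _ = false

pdef : {n : ℕ} {G : Graph n} (𝓗 : Cover G) → PartialColoring 𝓗 → Fin n → ℕ
pdef {n} {G} 𝓗 φ w =
  sum (map (λ x → if adj G w x ∧ bothAdj 𝓗 w x (φ w) (φ x) then 1 else 0) (allFin n))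

ThreeDefective : {n : ℕ} {G : Graph n} (𝓗 : Cover G) → Coloring 𝓗 → Set
ThreeDefective {n} 𝓗 ψ = ∀ (w : Fin n) → def 𝓗 ψ w ≤ 3

PartialThreeDefective : {n : ℕ} {G : Graph n} (𝓗 : Cover G) → PartialColoring 𝓗 → Set
PartialThreeDefective {n} 𝓗 φ = ∀ (w : Fin n) → pdef 𝓗 φ w ≤ 3

HasDomain₂ : {n : ℕ} {G : Graph n} (𝓗 : Cover G) → PartialColoring 𝓗 → Fin n → Fin n → Set
HasDomain₂ {n} 𝓗 φ u v =
  (∀ x → (x ≡ u ⊎ x ≡ v) → ∃ λ c → φ x ≡ just c) ×
  (∀ x → x ≢ u → x ≢ v → φ x ≡ nothing)

Extends : {n : ℕ} {G : Graph n} (𝓗 : Cover G) → Coloring 𝓗 → PartialColoring 𝓗 → Set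
Extends {n} 𝓗 ψ φ = ∀ (x : Fin n) c → φ x ≡ just c → ψ x ≡ c

-- Reverse the cyclic order of the outer cycle if necessary, so that every vertex other than u and v
-- lies strictly between u and v. For an edge pq, call the vertices strictly between p and q its
-- arc; since edges do not cross, an arc vertex has all its neighbors in the closed arc. By
-- induction on the arc, any coloring can be recolored on the arc so that, counting only conflicts
-- within the closed arc, arc vertices have defect at most 3, p at most the conflict on pq, and q at
-- most one more. If the arc is nonempty, pq lies on a triangle pwq with w in the arc: color w
-- without conflict with p, treat the arc of pw with p as its tight end and then the arc of wq with
-- q as its tight end (the same statement for the reversed order). The ends keep their bounds, and
-- w collects at most 1 + 2 conflicts. For the edge uv this gives def u ≤ conflict(u,v) and
-- def v ≤ 1 + conflict(u,v).

module Submission where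

open import Defs hiding (sym)
open import Data.Bool using (true; false; _∧_; if_then_else_)
open import Data.Bool.Properties using (∧-zeroʳ)
open import Data.Empty using (⊥-elim)
open import Data.Fin using (Fin; zero; suc; toℕ; fromℕ<; _≟_)
open import Data.Fin.Properties using (toℕ-injective; toℕ<n; toℕ-fromℕ<; any?; suc-injective)
open import Data.List using (tabulate; map; allFin)
open import Data.List.Properties using (map-tabulate)
open import Data.Maybe using (just; nothing; fromMaybe)
open import Data.Nat using (ℕ; zero; suc; _+_; _∸_; _≤_; _<_; _⊓_; _⊔_; z≤n; s≤s)
import Data.Nat as ℕ
import Data.Nat.ListAction as ℕList
open import Data.Nat.Induction using (<-wellFounded)
open import Data.Nat.Properties hiding (_≟_; suc-injective)
open import Data.Product using (∃; ∃₂; _×_; _,_; proj₁)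
open import Data.Sum using (_⊎_; inj₁; inj₂; [_,_]′)
open import Function using (_∘_; id)
open import Induction.WellFounded using (Acc; acc)
open import Level using (Level; 0ℓ)
open import Relation.Binary.Definitions using (tri<; tri≈; tri>)
open import Relation.Binary.PropositionalEquality
open import Relation.Nullary using (¬_; Dec; yes; no; does; contradiction; contraposition)
open import Relation.Nullary.Decidable using (_×-dec_; _⊎-dec_)
open import Relation.Unary using (Pred; Decidable; _⊆_; _∪_; ｛_｝)
open import Relation.Unary.Properties using (_∪?_; U?)

open import Algebra.Properties.CommutativeMonoid.Sum +-0-commutativeMonoid
  using (sum-syntax; ∑-distrib-+; sum-cong-≗)

private variable
  ℓ ℓ₁ ℓ₂ : Level
  m n : ℕ

-- Sums over Fin

∑-mono-≤ : {f g : Fin m → ℕ} → (∀ i → f i ≤ g i) → ∑[ i < m ] f i ≤ ∑[ i < m ] g i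
∑-mono-≤ {zero}  f≤g = z≤n
∑-mono-≤ {suc m} f≤g = +-mono-≤ (f≤g zero) (∑-mono-≤ (f≤g ∘ suc))

∑-mono-< : {f g : Fin m → ℕ} (j : Fin m) → (∀ i → f i ≤ g i) → f j < g j →
           ∑[ i < m ] f i < ∑[ i < m ] g i
∑-mono-< zero    f≤g fj<gj = +-mono-<-≤ fj<gj (∑-mono-≤ (f≤g ∘ suc))
∑-mono-< (suc j) f≤g fj<gj = +-mono-≤-< (f≤g zero) (∑-mono-< j (f≤g ∘ suc) fj<gj)

∑-zero : {f : Fin m → ℕ} → (∀ i → f i ≡ 0) → ∑[ i < m ] f i ≡ 0
∑-zero {zero}  f≡0 = refl
∑-zero {suc m} f≡0 rewrite f≡0 zero = ∑-zero (f≡0 ∘ suc)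

∑-pointed : {f : Fin m → ℕ} (j : Fin m) → (∀ i → i ≢ j → f i ≡ 0) → ∑[ i < m ] f i ≡ f j
∑-pointed {suc m} {f} zero    f≡0
  rewrite ∑-zero {f = f ∘ suc} (λ i → f≡0 (suc i) λ ()) = +-identityʳ (f zero)
∑-pointed {suc m} {f} (suc j) f≡0
  rewrite f≡0 zero (λ ()) = ∑-pointed j (λ i i≢j → f≡0 (suc i) (i≢j ∘ suc-injective))

sum-map-allFin : (f : Fin m → ℕ) → ℕList.sum (map f (allFin m)) ≡ ∑[ i < m ] f i
sum-map-allFin {m} f = trans (cong ℕList.sum (map-tabulate id f)) (sum-tabulate f)
  where
  sum-tabulate : ∀ {k} (g : Fin k → ℕ) → ℕList.sum (tabulate g) ≡ ∑[ i < k ] g i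
  sum-tabulate {zero}  g = refl
  sum-tabulate {suc k} g = cong (g zero +_) (sum-tabulate (g ∘ suc))

restrict : {P : Pred (Fin m) ℓ} → Decidable P → (Fin m → ℕ) → Fin m → ℕ
restrict P? f i = if does (P? i) then f i else 0

∑∈ : {P : Pred (Fin m) ℓ} → Decidable P → (Fin m → ℕ) → ℕ
∑∈ {m} P? f = ∑[ i < m ] restrict P? f i

syntax ∑∈ P? (λ i → x) = ∑[ i ∈ P? ] x

module _ {P : Pred (Fin m) ℓ₁} {Q : Pred (Fin m) ℓ₂} (P? : Decidable P) (Q? : Decidable Q)
         {f : Fin m → ℕ} where

  restrict-mono : (∀ {i} → P i → f i ≢ 0 → Q i) → ∀ i → restrict P? f i ≤ restrict Q? f i
  restrict-mono P⊆Q i with P? i | Q? i | f i ℕ.≟ 0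
  ... | no _  | _     | _        = z≤n
  ... | yes _ | yes _ | _        = ≤-refl
  ... | yes _ | no _  | yes fi≡0 = ≤-reflexive fi≡0
  ... | yes p | no ¬q | no fi≢0  = contradiction (P⊆Q p fi≢0) ¬q

  ∑∈-mono : (∀ {i} → P i → f i ≢ 0 → Q i) → ∑∈ P? f ≤ ∑∈ Q? f
  ∑∈-mono P⊆Q = ∑-mono-≤ (restrict-mono P⊆Q)

  ∑∈-mono-< : ∀ {j} → P ⊆ Q → Q j → ¬ P j → 0 < f j → ∑∈ P? f < ∑∈ Q? f
  ∑∈-mono-< {j} P⊆Q qj ¬pj 0<fj = ∑-mono-< j (restrict-mono (λ p _ → P⊆Q p)) at-j
    where
    at-j : restrict P? f j < restrict Q? f j
    at-j with P? j | Q? j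
    ... | yes pj | _      = contradiction pj ¬pj
    ... | no _   | yes _  = 0<fj
    ... | no _   | no ¬qj = contradiction qj ¬qj

  ∑∈-⊆-∪ : ∀ {R : Pred (Fin m) ℓ} (R? : Decidable R) →
           (∀ {i} → P i → f i ≢ 0 → Q i ⊎ R i) → ∑∈ P? f ≤ ∑∈ Q? f + ∑∈ R? f
  ∑∈-⊆-∪ R? P⊆Q∪R = ≤-trans (∑-mono-≤ pointwise) (≤-reflexive (∑-distrib-+ {m} _ _))
    where
    pointwise : ∀ i → restrict P? f i ≤ restrict Q? f i + restrict R? f i
    pointwise i with P? i | Q? i | R? i | f i ℕ.≟ 0
    ... | no _  | _     | _     | _        = z≤n
    ... | yes _ | yes _ | _     | _        = m≤m+n _ _
    ... | yes _ | no _  | yes _ | _        = ≤-refl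
    ... | yes _ | no _  | no _  | yes fi≡0 = ≤-reflexive fi≡0
    ... | yes p | no ¬q | no ¬r | no fi≢0  =
      [ (λ q → contradiction q ¬q) , (λ r → contradiction r ¬r) ]′ (P⊆Q∪R p fi≢0)

module _ {P : Pred (Fin m) ℓ} (P? : Decidable P) {f g : Fin m → ℕ} where

  ∑∈-cong : (∀ {i} → P i → f i ≡ g i) → ∑∈ P? f ≡ ∑∈ P? g
  ∑∈-cong f≗g = sum-cong-≗ pointwise
    where
    pointwise : ∀ i → restrict P? f i ≡ restrict P? g i
    pointwise i with P? i
    ... | yes p = f≗g p
    ... | no _  = refl

∑∈-｛｝ : (f : Fin m → ℕ) (j : Fin m) → ∑∈ (j ≟_) f ≡ f j
∑∈-｛｝ f j = trans (∑-pointed j off-j) (at-j (j ≟ j))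
  where
  off-j : ∀ i → i ≢ j → restrict (j ≟_) f i ≡ 0
  off-j i i≢j with j ≟ i
  ... | yes j≡i = contradiction (sym j≡i) i≢j
  ... | no _    = refl
  at-j : (d : Dec (j ≡ j)) → (if does d then f j else 0) ≡ f j
  at-j (yes _)  = refl
  at-j (no j≢j) = contradiction refl j≢j

-- Cyclic orders

record CyclicOrder (n : ℕ) : Set₁ where
  field
    Btw        : Fin n → Fin n → Fin n → Set
    btw?       : ∀ x y z → Dec (Btw x y z)
    btw-rotate : ∀ {x y z} → Btw x y z → Btw y z x
    btw-asym   : ∀ {x y z} → Btw x y z → ¬ Btw x z y
    btw-trans  : ∀ {w x y z} → Btw w x y → Btw w y z → Btw w x z
    btw-total  : ∀ {x y z} → x ≢ y → y ≢ z → x ≢ z → Btw x y z ⊎ Btw x z y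

  btw-rotate² : ∀ {x y z} → Btw x y z → Btw z x y
  btw-rotate² = btw-rotate ∘ btw-rotate

  btw-≢₁₂ : ∀ {x y z} → Btw x y z → x ≢ y
  btw-≢₁₂ xxz refl = btw-asym xxz (btw-rotate xxz)

  btw-≢₂₃ : ∀ {x y z} → Btw x y z → y ≢ z
  btw-≢₂₃ xyy refl = btw-asym xyy xyy

  btw-≢₁₃ : ∀ {x y z} → Btw x y z → x ≢ z
  btw-≢₁₃ xyz refl = btw-≢₂₃ (btw-rotate xyz) refl

  Open : Fin n → Fin n → Pred (Fin n) 0ℓ
  Open p q y = Btw p y q

  Closed : Fin n → Fin n → Pred (Fin n) 0ℓ
  Closed p q = ｛ p ｝ ∪ ｛ q ｝ ∪ Open p q

  closed? : ∀ p q → Decidable (Closed p q)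
  closed? p q = (p ≟_) ∪? (q ≟_) ∪? λ y → btw? p y q

  Closed-total : ∀ {u v} → (∀ {x} → x ≢ u → x ≢ v → Btw u x v) → ∀ y → Closed u v y
  Closed-total {u} {v} spans y with u ≟ y | v ≟ y
  ... | yes u≡y | _       = inj₁ u≡y
  ... | no _    | yes v≡y = inj₂ (inj₁ v≡y)
  ... | no u≢y  | no v≢y  = inj₂ (inj₂ (spans (u≢y ∘ sym) (v≢y ∘ sym)))

  arcSize : Fin n → Fin n → ℕ
  arcSize p q = ∑[ y ∈ (λ y → btw? p y q) ] 1

  module _ {p w q} (pwq : Btw p w q) where

    Open-⊆ˡ : Open p w ⊆ Open p q
    Open-⊆ˡ pyw = btw-trans pyw pwq

    Open-⊆ʳ : Open w q ⊆ Open p q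
    Open-⊆ʳ wyq = btw-rotate (btw-trans (btw-rotate² pwq) (btw-rotate² wyq))

    Open-disjoint : ∀ {y} → Open p w y → ¬ Open w q y
    Open-disjoint pyw wyq = btw-asym (btw-trans wyq (btw-rotate pwq)) (btw-rotate² pyw)

    Open-split : ∀ {y} → Open p q y → y ≡ w ⊎ Open p w y ⊎ Open w q y
    Open-split {y} pyq with y ≟ w
    ... | yes y≡w = inj₁ y≡w
    ... | no y≢w with btw-total (btw-≢₁₂ pyq) y≢w (btw-≢₁₂ pwq)
    ...   | inj₁ pyw = inj₂ (inj₁ pyw)
    ...   | inj₂ pwy with btw-total (y≢w ∘ sym) (btw-≢₂₃ pyq) (btw-≢₂₃ pwq)
    ...     | inj₁ wyq = inj₂ (inj₂ wyq)
    ...     | inj₂ wqy = contradiction (btw-rotate² wqy)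
                           (btw-asym (btw-trans (btw-rotate pyq) (btw-rotate² pwy)))

    arcSize-<ˡ : arcSize p w < arcSize p q
    arcSize-<ˡ = ∑∈-mono-< (λ y → btw? p y w) (λ y → btw? p y q) Open-⊆ˡ pwq (λ pww → btw-≢₂₃ pww refl) (s≤s z≤n)

    arcSize-<ʳ : arcSize w q < arcSize p q
    arcSize-<ʳ = ∑∈-mono-< (λ y → btw? w y q) (λ y → btw? p y q) Open-⊆ʳ pwq (λ wwq → btw-≢₁₂ wwq refl) (s≤s z≤n)

reverseCyclic : CyclicOrder n → CyclicOrder n
reverseCyclic O = record
  { Btw        = λ x y z → Btw z y x
  ; btw?       = λ x y z → btw? z y x
  ; btw-rotate = btw-rotate²
  ; btw-asym   = λ xyz xzy → btw-asym xyz (btw-rotate xzy)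
  ; btw-trans  = λ wxy wyz → btw-rotate (btw-trans (btw-rotate² wyz) (btw-rotate² wxy))
  ; btw-total  = λ x≢y y≢z x≢z → [ inj₂ ∘ btw-rotate , inj₁ ∘ btw-rotate ]′ (btw-total x≢y y≢z x≢z)
  }
  where open CyclicOrder O

-- Outerplanar orders

Adj : Graph n → Fin n → Fin n → Set
Adj G a b = adj G a b ≡ true

module _ {G : Graph n} where

  adj-sym : ∀ {a b} → Adj G a b → Adj G b a
  adj-sym {a} {b} ab = trans (Graph.sym G b a) ab

  adj-≢ : ∀ {a b} → Adj G a b → a ≢ b
  adj-≢ {a} aa refl with trans (sym aa) (irefl G a)
  ... | ()

module _ (G : Graph n) (O : CyclicOrder n) where
  open CyclicOrder O

  NonCrossing : Set
  NonCrossing = ∀ {a b x y} → Adj G a b → Adj G x y → Btw a x b → ¬ Btw b y a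

  Triangular : Set
  Triangular = ∀ {a b x} → Adj G a b → Btw a x b → ∃ λ w → Btw a w b × Adj G a w × Adj G w b

module _ {G : Graph n} (O : CyclicOrder n) where
  open CyclicOrder O

  -- Descend from the cycle successor of a: if a neighbor w of a in the arc of ab is not adjacent
  -- to b, an edge separating w from b can only end at a (otherwise it crosses ab or aw), which
  -- gives a neighbor of a closer to b.
  triangular-bySeparation :
    NonCrossing G O →
    (∀ {a b} → a ≢ b → adj G a b ≡ false → ∃₂ λ c d → Adj G c d × Btw a c b × Btw b d a) →
    (∀ {a b x} → Btw a x b → ∃ λ s → Btw a s b × Adj G a s) →
    Triangular G O
  triangular-bySeparation nonCrossing separated successor {a} {b} ab axb =
    let s , asb , as = successor axb in descend asb as (<-wellFounded (arcSize s b))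
    where
    descend : ∀ {w} → Btw a w b → Adj G a w → Acc _<_ (arcSize w b) →
              ∃ λ w′ → Btw a w′ b × Adj G a w′ × Adj G w′ b
    descend {w} awb aw (acc smaller) with adj G w b in wb
    ... | true  = w , awb , aw , wb
    ... | false with separated (btw-≢₂₃ awb) wb
    ...   | c , d , cd , wcb , bdw with Open-split (btw-rotate² awb) bdw
    ...     | inj₁ refl       = descend (Open-⊆ʳ awb wcb) (adj-sym {G = G} cd) (smaller (arcSize-<ʳ wcb))
    ...     | inj₂ (inj₁ bda) = ⊥-elim (nonCrossing ab cd (Open-⊆ʳ awb wcb) bda)
    ...     | inj₂ (inj₂ adw) = ⊥-elim (nonCrossing aw (adj-sym {G = G} cd) adw (btw-trans wcb (btw-rotate awb)))

record OuterplanarOrder (G : Graph n) : Set₁ where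
  field
    cyclicOrder : CyclicOrder n
    nonCrossing : NonCrossing G cyclicOrder
    triangular  : Triangular G cyclicOrder

  open CyclicOrder cyclicOrder public

  neighbor-closed : ∀ {a b x y} → Adj G a b → Btw a x b → Adj G x y → Closed a b y
  neighbor-closed {a} {b} {x} {y} ab axb xy with a ≟ y | b ≟ y
  ... | yes a≡y | _       = inj₁ a≡y
  ... | no _    | yes b≡y = inj₂ (inj₁ b≡y)
  ... | no a≢y  | no b≢y  with btw-total a≢y (b≢y ∘ sym) (btw-≢₁₃ axb)
  ...   | inj₁ ayb = inj₂ (inj₂ ayb)
  ...   | inj₂ aby = contradiction (btw-rotate aby) (nonCrossing ab xy axb)

reverse : {G : Graph n} → OuterplanarOrder G → OuterplanarOrder G
reverse {G = G} O = record
  { cyclicOrder = reverseCyclic cyclicOrder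
  ; nonCrossing = λ ab → nonCrossing (adj-sym {G = G} ab)
  ; triangular  = λ ab bxa → reversed (triangular (adj-sym {G = G} ab) bxa)
  }
  where
  open OuterplanarOrder O
  reversed : ∀ {a b} → (∃ λ w → Btw b w a × Adj G b w × Adj G w a) → ∃ λ w → Btw b w a × Adj G a w × Adj G w b
  reversed (w , bwa , bw , wa) = w , bwa , adj-sym {G = G} wa , adj-sym {G = G} bw

-- Extending colorings along arcs

module ColoringExtension {G : Graph n} (𝓗 : Cover G) (twoFold : TwoFold 𝓗) where

  conflict : Coloring 𝓗 → Fin n → Fin n → ℕ
  conflict ψ x y = if adj G x y ∧ match 𝓗 x y (ψ x) (ψ y) then 1 else 0

  def≡∑conflict : ∀ ψ x → def 𝓗 ψ x ≡ ∑[ y < n ] conflict ψ x y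
  def≡∑conflict ψ x = sum-map-allFin (conflict ψ x)

  conflict≤1 : ∀ ψ x y → conflict ψ x y ≤ 1
  conflict≤1 ψ x y with adj G x y ∧ match 𝓗 x y (ψ x) (ψ y)
  ... | true  = ≤-refl
  ... | false = z≤n

  conflict-sym : ∀ ψ x y → conflict ψ x y ≡ conflict ψ y x
  conflict-sym ψ x y =
    cong₂ (λ a m → if a ∧ m then 1 else 0) (Graph.sym G x y) (msym 𝓗 x y (ψ x) (ψ y))

  conflict-cong : ∀ {ψ ψ′ x y} → ψ x ≡ ψ′ x → ψ y ≡ ψ′ y → conflict ψ x y ≡ conflict ψ′ x y
  conflict-cong {x = x} {y} = cong₂ λ a b → if adj G x y ∧ match 𝓗 x y a b then 1 else 0

  conflict≢0⇒adj : ∀ {ψ x y} → conflict ψ x y ≢ 0 → Adj G x y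
  conflict≢0⇒adj {x = x} {y} conflict≢0 with adj G x y
  ... | true  = refl
  ... | false = contradiction refl conflict≢0

  conflict-unmatched : ∀ {ψ x y} → match 𝓗 x y (ψ x) (ψ y) ≡ false → conflict ψ x y ≡ 0
  conflict-unmatched {x = x} {y} unmatched rewrite unmatched | ∧-zeroʳ (adj G x y) = refl

  _[_]≔_ : Coloring 𝓗 → (w : Fin n) → Fin (size 𝓗 w) → Coloring 𝓗
  (ψ [ w ]≔ c) y with y ≟ w
  ... | yes refl = c
  ... | no _     = ψ y

  []≔-updates : ∀ ψ w c → (ψ [ w ]≔ c) w ≡ c
  []≔-updates ψ w c with w ≟ w
  ... | yes refl = refl
  ... | no w≢w   = contradiction refl w≢w

  []≔-minimal : ∀ ψ w c {y} → y ≢ w → (ψ [ w ]≔ c) y ≡ ψ y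
  []≔-minimal ψ w c {y} y≢w with y ≟ w
  ... | yes y≡w = contradiction y≡w y≢w
  ... | no _    = refl

  distinctColors : ∀ y → ∃₂ λ (c₀ c₁ : Fin (size 𝓗 y)) → c₀ ≢ c₁
  distinctColors y = fromℕ< (≤-trans (s≤s z≤n) (twoFold y)) , fromℕ< (twoFold y) , 0≢1 ∘ cong toℕ
    where
    0≢1 : toℕ (fromℕ< (≤-trans (s≤s z≤n) (twoFold y))) ≢ toℕ (fromℕ< {1} (twoFold y))
    0≢1 eq with trans (sym (toℕ-fromℕ< _)) (trans eq (toℕ-fromℕ< _))
    ... | ()

  unmatchedColor : ∀ x y (a : Fin (size 𝓗 x)) → ∃ λ c → match 𝓗 x y a c ≡ false
  unmatchedColor x y a with distinctColors y
  ... | c₀ , c₁ , c₀≢c₁ with match 𝓗 x y a c₀ in m₀ | match 𝓗 x y a c₁ in m₁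
  ...   | false | _     = c₀ , m₀
  ...   | true  | false = c₁ , m₁
  ...   | true  | true  = contradiction (mmatch 𝓗 x y a c₀ c₁ m₀ m₁) c₀≢c₁

  module _ (O : CyclicOrder n) where
    open CyclicOrder O

    arcDefect : Fin n → Fin n → Coloring 𝓗 → Fin n → ℕ
    arcDefect p q ψ x = ∑[ y ∈ closed? p q ] conflict ψ x y

    record ArcExtension (p q : Fin n) (ψ₀ ψ : Coloring 𝓗) : Set where
      field
        unchanged : ∀ {y} → ¬ Btw p y q → ψ y ≡ ψ₀ y
        interior  : ∀ {x} → Btw p x q → arcDefect p q ψ x ≤ 3
        tightEnd  : arcDefect p q ψ p ≤ conflict ψ p q
        looseEnd  : arcDefect p q ψ q ≤ suc (conflict ψ p q)

  emptyArcExtension : (O : CyclicOrder n) → ∀ {p q} → (∀ x → ¬ CyclicOrder.Btw O p x q) →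
                      (ψ : Coloring 𝓗) → ArcExtension O p q ψ ψ
  emptyArcExtension O {p} {q} emptyArc ψ = record
    { unchanged = λ _ → refl
    ; interior  = λ {x} pxq → contradiction pxq (emptyArc x)
    ; tightEnd  = ≤-trans (∑∈-mono (closed? p q) (q ≟_) onlyQ)
                          (≤-reflexive (∑∈-｛｝ (conflict ψ p) q))
    ; looseEnd  = ≤-trans (∑∈-mono (closed? p q) (p ≟_) onlyP)
                          (≤-trans (≤-reflexive (trans (∑∈-｛｝ (conflict ψ q) p) (conflict-sym ψ q p)))
                                   (n≤1+n _))
    }
    where
    open CyclicOrder O
    irreflexive : ∀ {x} → conflict ψ x x ≢ 0 → ∀ {A : Set} → A
    irreflexive x≁x = contradiction refl (adj-≢ {G = G} (conflict≢0⇒adj {ψ = ψ} x≁x))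
    onlyQ : ∀ {y} → Closed p q y → conflict ψ p y ≢ 0 → q ≡ y
    onlyQ (inj₁ refl)        p≁p = irreflexive p≁p
    onlyQ (inj₂ (inj₁ q≡y))  _   = q≡y
    onlyQ (inj₂ (inj₂ pyq))  _   = contradiction pyq (emptyArc _)
    onlyP : ∀ {y} → Closed p q y → conflict ψ q y ≢ 0 → p ≡ y
    onlyP (inj₁ p≡y)         _   = p≡y
    onlyP (inj₂ (inj₁ refl)) q≁q = irreflexive q≁q
    onlyP (inj₂ (inj₂ pyq))  _   = contradiction pyq (emptyArc _)

  module Glue (O : OuterplanarOrder G) {p w q} (pwq : OuterplanarOrder.Btw O p w q)
              (pw : Adj G p w) (wq : Adj G w q) {ψ₀ ψ₂ ψ₃ : Coloring 𝓗} {c : Fin (size 𝓗 w)}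
              (unmatched : match 𝓗 p w (ψ₀ p) c ≡ false)
              (E₁ : ArcExtension (OuterplanarOrder.cyclicOrder O) p w (ψ₀ [ w ]≔ c) ψ₂)
              (E₂ : ArcExtension (OuterplanarOrder.cyclicOrder (reverse O)) q w ψ₂ ψ₃) where

    open OuterplanarOrder O
    private
      module R  = OuterplanarOrder (reverse O)
      module E₁ = ArcExtension E₁
      module E₂ = ArcExtension E₂
      Oᶜ = cyclicOrder
      Rᶜ = R.cyclicOrder

    p∉[w,q] : ¬ Closed w q p
    p∉[w,q] (inj₁ w≡p)        = btw-≢₁₂ pwq (sym w≡p)
    p∉[w,q] (inj₂ (inj₁ q≡p)) = btw-≢₁₃ pwq (sym q≡p)
    p∉[w,q] (inj₂ (inj₂ wpq)) = btw-asym (btw-rotate pwq) wpq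

    q∉[p,w] : ¬ Closed p w q
    q∉[p,w] (inj₁ p≡q)        = btw-≢₁₃ pwq p≡q
    q∉[p,w] (inj₂ (inj₁ w≡q)) = btw-≢₂₃ pwq w≡q
    q∉[p,w] (inj₂ (inj₂ pqw)) = btw-asym pwq pqw

    closed-split : ∀ {y} → Closed p q y → Closed p w y ⊎ R.Closed q w y
    closed-split (inj₁ p≡y)        = inj₁ (inj₁ p≡y)
    closed-split (inj₂ (inj₁ q≡y)) = inj₂ (inj₁ q≡y)
    closed-split (inj₂ (inj₂ pyq)) with Open-split pwq pyq
    ... | inj₁ refl       = inj₁ (inj₂ (inj₁ refl))
    ... | inj₂ (inj₁ pyw) = inj₁ (inj₂ (inj₂ pyw))
    ... | inj₂ (inj₂ wyq) = inj₂ (inj₂ (inj₂ wyq))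

    ψ₃≡ψ₂ : ∀ {y} → Closed p w y → ψ₃ y ≡ ψ₂ y
    ψ₃≡ψ₂ (inj₁ refl)        = E₂.unchanged (btw-asym (btw-rotate pwq))
    ψ₃≡ψ₂ (inj₂ (inj₁ refl)) = E₂.unchanged λ wwq → btw-≢₁₂ wwq refl
    ψ₃≡ψ₂ (inj₂ (inj₂ pyw))  = E₂.unchanged (Open-disjoint pwq pyw)

    unchanged : ∀ {y} → ¬ Btw p y q → ψ₃ y ≡ ψ₀ y
    unchanged {y} ¬pyq = begin
      ψ₃ y            ≡⟨ E₂.unchanged (contraposition (Open-⊆ʳ pwq) ¬pyq) ⟩
      ψ₂ y            ≡⟨ E₁.unchanged (contraposition (Open-⊆ˡ pwq) ¬pyq) ⟩
      (ψ₀ [ w ]≔ c) y ≡⟨ []≔-minimal ψ₀ w c (λ { refl → ¬pyq pwq }) ⟩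
      ψ₀ y            ∎
      where open ≡-Reasoning

    p≁w : conflict ψ₂ p w ≡ 0
    p≁w = conflict-unmatched (begin
      match 𝓗 p w (ψ₂ p) (ψ₂ w)
        ≡⟨ cong₂ (match 𝓗 p w) (E₁.unchanged (λ ppw → btw-≢₁₂ ppw refl))
                               (E₁.unchanged (λ pww → btw-≢₂₃ pww refl)) ⟩
      match 𝓗 p w ((ψ₀ [ w ]≔ c) p) ((ψ₀ [ w ]≔ c) w)
        ≡⟨ cong₂ (match 𝓗 p w) ([]≔-minimal ψ₀ w c (btw-≢₁₂ pwq)) ([]≔-updates ψ₀ w c) ⟩
      match 𝓗 p w (ψ₀ p) c
        ≡⟨ unmatched ⟩
      false ∎)
      where open ≡-Reasoning

    open ≤-Reasoning

    ∼⇒adj : ∀ {x y} → conflict ψ₃ x y ≢ 0 → Adj G x y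
    ∼⇒adj = conflict≢0⇒adj {ψ = ψ₃}

    [p,w]-unaffected : ∀ {x} → Closed p w x → arcDefect Oᶜ p w ψ₃ x ≡ arcDefect Oᶜ p w ψ₂ x
    [p,w]-unaffected x∈ = ∑∈-cong (closed? p w) λ y∈ → conflict-cong (ψ₃≡ψ₂ x∈) (ψ₃≡ψ₂ y∈)

    arcDefect-split : ∀ x → arcDefect Oᶜ p q ψ₃ x ≤ arcDefect Oᶜ p w ψ₃ x + arcDefect Rᶜ q w ψ₃ x
    arcDefect-split x = ∑∈-⊆-∪ (closed? p q) (closed? p w) (R.closed? q w) (λ y∈ _ → closed-split y∈)

    tightEnd : arcDefect Oᶜ p q ψ₃ p ≤ conflict ψ₃ p q
    tightEnd = begin
      arcDefect Oᶜ p q ψ₃ p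
        ≤⟨ ∑∈-⊆-∪ (closed? p q) (closed? p w) (q ≟_) cover ⟩
      arcDefect Oᶜ p w ψ₃ p + ∑∈ (q ≟_) (conflict ψ₃ p)
        ≡⟨ cong₂ _+_ ([p,w]-unaffected (inj₁ refl)) (∑∈-｛｝ _ q) ⟩
      arcDefect Oᶜ p w ψ₂ p + conflict ψ₃ p q
        ≤⟨ +-monoˡ-≤ _ E₁.tightEnd ⟩
      conflict ψ₂ p w + conflict ψ₃ p q
        ≡⟨ cong (_+ conflict ψ₃ p q) p≁w ⟩
      conflict ψ₃ p q ∎
      where
      cover : ∀ {y} → Closed p q y → conflict ψ₃ p y ≢ 0 → Closed p w y ⊎ q ≡ y
      cover y∈ p∼y with closed-split y∈
      ... | inj₁ y∈[p,w]           = inj₁ y∈[p,w]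
      ... | inj₂ (inj₁ q≡y)        = inj₂ q≡y
      ... | inj₂ (inj₂ (inj₁ w≡y)) = inj₁ (inj₂ (inj₁ w≡y))
      ... | inj₂ (inj₂ (inj₂ wyq)) = contradiction (neighbor-closed wq wyq (adj-sym {G = G} (∼⇒adj p∼y))) p∉[w,q]

    looseEnd : arcDefect Oᶜ p q ψ₃ q ≤ suc (conflict ψ₃ p q)
    looseEnd = begin
      arcDefect Oᶜ p q ψ₃ q
        ≤⟨ ∑∈-⊆-∪ (closed? p q) (p ≟_) (R.closed? q w) cover ⟩
      ∑∈ (p ≟_) (conflict ψ₃ q) + arcDefect Rᶜ q w ψ₃ q
        ≡⟨ cong (_+ arcDefect Rᶜ q w ψ₃ q) (trans (∑∈-｛｝ _ p) (conflict-sym ψ₃ q p)) ⟩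
      conflict ψ₃ p q + arcDefect Rᶜ q w ψ₃ q
        ≤⟨ +-monoʳ-≤ _ (≤-trans E₂.tightEnd (conflict≤1 ψ₃ q w)) ⟩
      conflict ψ₃ p q + 1
        ≡⟨ +-comm _ 1 ⟩
      suc (conflict ψ₃ p q) ∎
      where
      cover : ∀ {y} → Closed p q y → conflict ψ₃ q y ≢ 0 → p ≡ y ⊎ R.Closed q w y
      cover y∈ q∼y with closed-split y∈
      ... | inj₂ y∈[w,q]           = inj₂ y∈[w,q]
      ... | inj₁ (inj₁ p≡y)        = inj₁ p≡y
      ... | inj₁ (inj₂ (inj₁ w≡y)) = inj₂ (inj₂ (inj₁ w≡y))
      ... | inj₁ (inj₂ (inj₂ pyw)) = contradiction (neighbor-closed pw pyw (adj-sym {G = G} (∼⇒adj q∼y))) q∉[p,w]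

    middle : arcDefect Oᶜ p q ψ₃ w ≤ 3
    middle = begin
      arcDefect Oᶜ p q ψ₃ w
        ≤⟨ arcDefect-split w ⟩
      arcDefect Oᶜ p w ψ₃ w + arcDefect Rᶜ q w ψ₃ w
        ≡⟨ cong (_+ arcDefect Rᶜ q w ψ₃ w) ([p,w]-unaffected (inj₂ (inj₁ refl))) ⟩
      arcDefect Oᶜ p w ψ₂ w + arcDefect Rᶜ q w ψ₃ w
        ≤⟨ +-mono-≤ E₁.looseEnd E₂.looseEnd ⟩
      suc (conflict ψ₂ p w) + suc (conflict ψ₃ q w)
        ≤⟨ +-mono-≤ (≤-reflexive (cong suc p≁w)) (s≤s (conflict≤1 ψ₃ q w)) ⟩
      1 + 2 ∎

    interior : ∀ {x} → Btw p x q → arcDefect Oᶜ p q ψ₃ x ≤ 3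
    interior {x} pxq with Open-split pwq pxq
    ... | inj₁ refl       = middle
    ... | inj₂ (inj₁ pxw) = begin
      arcDefect Oᶜ p q ψ₃ x
        ≤⟨ ∑∈-mono (closed? p q) (closed? p w) (λ _ x∼y → neighbor-closed pw pxw (∼⇒adj x∼y)) ⟩
      arcDefect Oᶜ p w ψ₃ x
        ≡⟨ [p,w]-unaffected (inj₂ (inj₂ pxw)) ⟩
      arcDefect Oᶜ p w ψ₂ x
        ≤⟨ E₁.interior pxw ⟩
      3 ∎
    ... | inj₂ (inj₂ wxq) = begin
      arcDefect Oᶜ p q ψ₃ x
        ≤⟨ ∑∈-mono (closed? p q) (R.closed? q w)
                   (λ _ x∼y → R.neighbor-closed (adj-sym {G = G} wq) wxq (∼⇒adj x∼y)) ⟩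
      arcDefect Rᶜ q w ψ₃ x
        ≤⟨ E₂.interior wxq ⟩
      3 ∎

    glued : ArcExtension Oᶜ p q ψ₀ ψ₃
    glued = record
      { unchanged = unchanged ; interior = interior ; tightEnd = tightEnd ; looseEnd = looseEnd }

  module _ where
    open OuterplanarOrder using (cyclicOrder; btw?; triangular; arcSize; arcSize-<ˡ; arcSize-<ʳ)

    extendArc : (O : OuterplanarOrder G) → ∀ {p q} → Adj G p q → (ψ₀ : Coloring 𝓗) →
                Acc _<_ (arcSize O p q) → ∃ (ArcExtension (cyclicOrder O) p q ψ₀)
    extendArc O {p} {q} pq ψ₀ (acc smaller) with any? (λ x → btw? O p x q)
    ... | no emptyArc = ψ₀ , emptyArcExtension (cyclicOrder O) (λ x pxq → emptyArc (x , pxq)) ψ₀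
    ... | yes (_ , pxq) with triangular O pq pxq
    ... | w , pwq , pw , wq with unmatchedColor p w (ψ₀ p)
    ... | c , unmatched with extendArc O pw (ψ₀ [ w ]≔ c) (smaller (arcSize-<ˡ O pwq))
    ... | ψ₂ , E₁ with extendArc (reverse O) (adj-sym {G = G} wq) ψ₂ (smaller (arcSize-<ʳ O pwq))
    ... | ψ₃ , E₂ = ψ₃ , Glue.glued O pwq pw wq unmatched E₁ E₂

  extendEdgeColoring : (O : OuterplanarOrder G) → ∀ {u v} → Adj G u v →
                        (∀ y → OuterplanarOrder.Closed O u v y) → (ψ₀ : Coloring 𝓗) →
                        ∃ λ ψ → ψ u ≡ ψ₀ u × ψ v ≡ ψ₀ v × ThreeDefective 𝓗 ψ ×
                                def 𝓗 ψ u ≤ conflict ψ₀ u v × def 𝓗 ψ v ≤ suc (conflict ψ₀ u v)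
  extendEdgeColoring O {u} {v} u∼v spanning ψ₀ with extendArc O u∼v ψ₀ (<-wellFounded _)
  ... | ψ , E = ψ , ψu≡ψ₀u , ψv≡ψ₀v , threeDefective , atU , atV
    where
    open OuterplanarOrder O
    open ArcExtension E
    ψu≡ψ₀u : ψ u ≡ ψ₀ u
    ψu≡ψ₀u = unchanged λ uuv → btw-≢₁₂ uuv refl
    ψv≡ψ₀v : ψ v ≡ ψ₀ v
    ψv≡ψ₀v = unchanged λ uvv → btw-≢₂₃ uvv refl
    def≤arcDefect : ∀ x → def 𝓗 ψ x ≤ arcDefect cyclicOrder u v ψ x
    def≤arcDefect x = ≤-trans (≤-reflexive (def≡∑conflict ψ x))
                              (∑∈-mono U? (closed? u v) λ {y} _ _ → spanning y)
    atU : def 𝓗 ψ u ≤ conflict ψ₀ u v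
    atU = ≤-trans (def≤arcDefect u) (≤-trans tightEnd (≤-reflexive (conflict-cong ψu≡ψ₀u ψv≡ψ₀v)))
    atV : def 𝓗 ψ v ≤ suc (conflict ψ₀ u v)
    atV = ≤-trans (def≤arcDefect v) (≤-trans looseEnd (≤-reflexive (cong suc (conflict-cong ψu≡ψ₀u ψv≡ψ₀v))))
    threeDefective : ThreeDefective 𝓗 ψ
    threeDefective x with spanning x
    ... | inj₁ refl        = ≤-trans atU (≤-trans (conflict≤1 ψ₀ u v) (s≤s z≤n))
    ... | inj₂ (inj₁ refl) = ≤-trans atV (s≤s (≤-trans (conflict≤1 ψ₀ u v) (s≤s z≤n)))
    ... | inj₂ (inj₂ uxv)  = ≤-trans (def≤arcDefect x) (interior uxv)

  completion : PartialColoring 𝓗 → Coloring 𝓗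
  completion φ x = fromMaybe (proj₁ (distinctColors x)) (φ x)

  completion-just : ∀ φ {x a} → φ x ≡ just a → completion φ x ≡ a
  completion-just φ = cong (fromMaybe _)

  completion-conflict : ∀ φ {u v a b} → φ u ≡ just a → φ v ≡ just b → match 𝓗 u v a b ≡ false →
                        conflict (completion φ) u v ≡ 0
  completion-conflict φ {u} {v} φu φv unmatched =
    conflict-unmatched (trans (cong₂ (match 𝓗 u v) (completion-just φ φu) (completion-just φ φv)) unmatched)

  completion-extends : ∀ {φ u v} ψ → (∀ x → x ≢ u → x ≢ v → φ x ≡ nothing) →
                       ψ u ≡ completion φ u → ψ v ≡ completion φ v → Extends 𝓗 ψ φ
  completion-extends {φ} {u} {v} ψ undefined ψu ψv x c φx≡c with x ≟ u | x ≟ v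
  ... | yes refl | _        = trans ψu (completion-just φ φx≡c)
  ... | no _     | yes refl = trans ψv (completion-just φ φx≡c)
  ... | no x≢u   | no x≢v   with trans (sym φx≡c) (undefined x x≢u x≢v)
  ...   | ()

-- The order of the outer cycle

CyclicallyOrdered : ℕ → ℕ → ℕ → Set
CyclicallyOrdered a b c = (a < b × b < c) ⊎ (b < c × c < a) ⊎ (c < a × a < b)

cyclicallyOrdered? : ∀ a b c → Dec (CyclicallyOrdered a b c)
cyclicallyOrdered? a b c =
  ((a <? b) ×-dec (b <? c)) ⊎-dec ((b <? c) ×-dec (c <? a)) ⊎-dec ((c <? a) ×-dec (a <? b))

cyclic-rotate : ∀ {a b c} → CyclicallyOrdered a b c → CyclicallyOrdered b c a
cyclic-rotate (inj₁ abc)        = inj₂ (inj₂ abc)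
cyclic-rotate (inj₂ (inj₁ bca)) = inj₁ bca
cyclic-rotate (inj₂ (inj₂ cab)) = inj₂ (inj₁ cab)

cyclic-asym : ∀ {a b c} → CyclicallyOrdered a b c → ¬ CyclicallyOrdered a c b
cyclic-asym (inj₁ (_ , b<c))        (inj₁ (_ , c<b))        = <-asym b<c c<b
cyclic-asym (inj₁ (_ , b<c))        (inj₂ (inj₁ (c<b , _))) = <-asym b<c c<b
cyclic-asym (inj₁ (a<b , _))        (inj₂ (inj₂ (b<a , _))) = <-asym a<b b<a
cyclic-asym (inj₂ (inj₁ (_ , c<a))) (inj₁ (a<c , _))        = <-asym c<a a<c
cyclic-asym (inj₂ (inj₁ (b<c , _))) (inj₂ (inj₁ (c<b , _))) = <-asym b<c c<b
cyclic-asym (inj₂ (inj₁ (_ , c<a))) (inj₂ (inj₂ (_ , a<c))) = <-asym c<a a<c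
cyclic-asym (inj₂ (inj₂ (c<a , _))) (inj₁ (a<c , _))        = <-asym c<a a<c
cyclic-asym (inj₂ (inj₂ (_ , a<b))) (inj₂ (inj₁ (_ , b<a))) = <-asym a<b b<a
cyclic-asym (inj₂ (inj₂ (_ , a<b))) (inj₂ (inj₂ (b<a , _))) = <-asym a<b b<a

cyclic-trans : ∀ {a b c d} → CyclicallyOrdered a b c → CyclicallyOrdered a c d → CyclicallyOrdered a b d
cyclic-trans (inj₁ (a<b , b<c))      (inj₁ (_ , c<d))          = inj₁ (a<b , <-trans b<c c<d)
cyclic-trans (inj₁ (a<b , b<c))      (inj₂ (inj₁ (c<d , d<a))) =
  contradiction (<-trans b<c (<-trans c<d d<a)) (<-asym a<b)
cyclic-trans (inj₁ (a<b , _))        (inj₂ (inj₂ (d<a , _)))   = inj₂ (inj₂ (d<a , a<b))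
cyclic-trans (inj₂ (inj₁ (_ , c<a))) (inj₁ (a<c , _))          = contradiction a<c (<-asym c<a)
cyclic-trans (inj₂ (inj₁ (b<c , _))) (inj₂ (inj₁ (c<d , d<a))) = inj₂ (inj₁ (<-trans b<c c<d , d<a))
cyclic-trans (inj₂ (inj₁ (_ , c<a))) (inj₂ (inj₂ (_ , a<c)))   = contradiction a<c (<-asym c<a)
cyclic-trans (inj₂ (inj₂ (c<a , _))) (inj₁ (a<c , _))          = contradiction a<c (<-asym c<a)
cyclic-trans (inj₂ (inj₂ (_ , a<b))) (inj₂ (inj₁ (_ , d<a)))   = inj₂ (inj₂ (d<a , a<b))
cyclic-trans (inj₂ (inj₂ (c<a , _))) (inj₂ (inj₂ (_ , a<c)))   = contradiction a<c (<-asym c<a)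

cyclic-total : ∀ {a b c} → a ≢ b → b ≢ c → a ≢ c → CyclicallyOrdered a b c ⊎ CyclicallyOrdered a c b
cyclic-total {a} {b} {c} a≢b b≢c a≢c with <-cmp a b | <-cmp b c | <-cmp a c
... | tri≈ _ a≡b _ | _            | _            = contradiction a≡b a≢b
... | _            | tri≈ _ b≡c _ | _            = contradiction b≡c b≢c
... | _            | _            | tri≈ _ a≡c _ = contradiction a≡c a≢c
... | tri< a<b _ _ | tri< b<c _ _ | _            = inj₁ (inj₁ (a<b , b<c))
... | tri< a<b _ _ | tri> _ _ c<b | tri< a<c _ _ = inj₂ (inj₁ (a<c , c<b))
... | tri< a<b _ _ | tri> _ _ c<b | tri> _ _ c<a = inj₁ (inj₂ (inj₂ (c<a , a<b)))
... | tri> _ _ b<a | tri< b<c _ _ | tri< a<c _ _ = inj₂ (inj₂ (inj₂ (b<a , a<c)))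
... | tri> _ _ b<a | tri< b<c _ _ | tri> _ _ c<a = inj₁ (inj₂ (inj₁ (b<c , c<a)))
... | tri> _ _ b<a | tri> _ _ c<b | _            = inj₂ (inj₂ (inj₁ (c<b , b<a)))

cyclic-suc : ∀ {a x b} → CyclicallyOrdered a x b → CyclicallyOrdered a (suc a) b
cyclic-suc {a} (inj₁ (a<x , x<b))   = inj₁ (n<1+n a , ≤-<-trans a<x x<b)
cyclic-suc {a} (inj₂ (inj₁ (_ , b<a))) = inj₂ (inj₂ (b<a , n<1+n a))
cyclic-suc {a} (inj₂ (inj₂ (b<a , _))) = inj₂ (inj₂ (b<a , n<1+n a))

cyclic-zero : ∀ {a x b} → x ≤ a → CyclicallyOrdered a x b → CyclicallyOrdered a 0 b
cyclic-zero x≤a (inj₁ (a<x , _))        = contradiction x≤a (<⇒≱ a<x)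
cyclic-zero x≤a (inj₂ (inj₁ (x<b , b<a))) = inj₂ (inj₁ (≤-<-trans z≤n x<b , b<a))
cyclic-zero x≤a (inj₂ (inj₂ (_ , a<x)))  = contradiction x≤a (<⇒≱ a<x)

cyclic-fromSuc : ∀ {u x} → x ≢ u → x ≢ suc u → CyclicallyOrdered (suc u) x u
cyclic-fromSuc {u} {x} x≢u x≢1+u with <-cmp x u
... | tri< x<u _ _ = inj₂ (inj₁ (x<u , n<1+n u))
... | tri≈ _ x≡u _ = contradiction x≡u x≢u
... | tri> _ _ u<x = inj₂ (inj₂ (n<1+n u , ≤∧≢⇒< u<x (x≢1+u ∘ sym)))

cyclic-fromZero : ∀ {x t} → x ≤ t → x ≢ t → x ≢ 0 → CyclicallyOrdered 0 x t
cyclic-fromZero x≤t x≢t x≢0 = inj₁ (n≢0⇒n>0 x≢0 , ≤∧≢⇒< x≤t x≢t)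

-- Defs.Cross a b c d is definitionally ChordsCross (toℕ a) (toℕ b) (toℕ c) (toℕ d).
SortedChordsCross : ℕ → ℕ → ℕ → ℕ → Set
SortedChordsCross l₁ h₁ l₂ h₂ = (l₁ < l₂ × l₂ < h₁ × h₁ < h₂) ⊎ (l₂ < l₁ × l₁ < h₂ × h₂ < h₁)

ChordsCross : ℕ → ℕ → ℕ → ℕ → Set
ChordsCross a b c d = SortedChordsCross (a ⊓ b) (a ⊔ b) (c ⊓ d) (c ⊔ d)

Separated : ℕ → ℕ → ℕ → ℕ → Set
Separated a b c d = (CyclicallyOrdered a c b × CyclicallyOrdered b d a)
                  ⊎ (CyclicallyOrdered a d b × CyclicallyOrdered b c a)

data SortedAs (a b : ℕ) : ℕ → ℕ → Set where
  increasing : a < b → SortedAs a b a b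
  decreasing : b < a → SortedAs a b b a
  degenerate : a ≡ b → SortedAs a b a b

sortedAs : ∀ a b → SortedAs a b (a ⊓ b) (a ⊔ b)
sortedAs a b with <-cmp a b
... | tri< a<b _ _ rewrite m≤n⇒m⊓n≡m (<⇒≤ a<b) | m≤n⇒m⊔n≡n (<⇒≤ a<b) = increasing a<b
... | tri> _ _ b<a rewrite m≥n⇒m⊓n≡n (<⇒≤ b<a) | m≥n⇒m⊔n≡m (<⇒≤ b<a) = decreasing b<a
... | tri≈ _ refl _ rewrite ⊓-idem a | ⊔-idem a = degenerate refl

chordsCross⇒separated : ∀ a b c d → SortedChordsCross (a ⊓ b) (a ⊔ b) (c ⊓ d) (c ⊔ d) → Separated a b c d
chordsCross⇒separated a b c d with a ⊓ b | a ⊔ b | sortedAs a b | c ⊓ d | c ⊔ d | sortedAs c d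
... | _ | _ | degenerate refl | _ | _ | _ = λ
  { (inj₁ (a<c , c<a , _)) → contradiction a<c (<-asym c<a)
  ; (inj₂ (_ , a<d , d<a)) → contradiction a<d (<-asym d<a) }
... | _ | _ | _ | _ | _ | degenerate refl = λ
  { (inj₁ (_ , c<b , b<c)) → contradiction c<b (<-asym b<c)
  ; (inj₂ (c<a , a<c , _)) → contradiction a<c (<-asym c<a) }
... | _ | _ | increasing a<b | _ | _ | increasing c<d = λ
  { (inj₁ (a<c , c<b , b<d)) → inj₁ (inj₁ (a<c , c<b) , inj₂ (inj₂ (a<b , b<d)))
  ; (inj₂ (c<a , a<d , d<b)) → inj₂ (inj₁ (a<d , d<b) , inj₂ (inj₁ (c<a , a<b))) }
... | _ | _ | increasing a<b | _ | _ | decreasing d<c = λ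
  { (inj₁ (a<d , d<b , b<c)) → inj₂ (inj₁ (a<d , d<b) , inj₂ (inj₂ (a<b , b<c)))
  ; (inj₂ (d<a , a<c , c<b)) → inj₁ (inj₁ (a<c , c<b) , inj₂ (inj₁ (d<a , a<b))) }
... | _ | _ | decreasing b<a | _ | _ | increasing c<d = λ
  { (inj₁ (b<c , c<a , a<d)) → inj₂ (inj₂ (inj₂ (b<a , a<d)) , inj₁ (b<c , c<a))
  ; (inj₂ (c<b , b<d , d<a)) → inj₁ (inj₂ (inj₁ (c<b , b<a)) , inj₁ (b<d , d<a)) }
... | _ | _ | decreasing b<a | _ | _ | decreasing d<c = λ
  { (inj₁ (b<d , d<a , a<c)) → inj₁ (inj₂ (inj₂ (b<a , a<c)) , inj₁ (b<d , d<a))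
  ; (inj₂ (d<b , b<c , c<a)) → inj₂ (inj₂ (inj₁ (d<b , b<a)) , inj₁ (b<c , c<a)) }

sortedChordsCross⇒chordsCross : ∀ {l₁ h₁ l₂ h₂} → l₁ < h₁ → l₂ < h₂ →
                                SortedChordsCross l₁ h₁ l₂ h₂ → ChordsCross l₁ h₁ l₂ h₂
sortedChordsCross⇒chordsCross l₁<h₁ l₂<h₂
  rewrite m≤n⇒m⊓n≡m (<⇒≤ l₁<h₁) | m≤n⇒m⊔n≡n (<⇒≤ l₁<h₁)
        | m≤n⇒m⊓n≡m (<⇒≤ l₂<h₂) | m≤n⇒m⊔n≡n (<⇒≤ l₂<h₂) = id

chordsCross-swapˡ : ∀ {a b c d} → ChordsCross a b c d → ChordsCross b a c d
chordsCross-swapˡ {a} {b} = subst₂ (λ l h → SortedChordsCross l h _ _) (⊓-comm a b) (⊔-comm a b)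

chordsCross-swapʳ : ∀ {a b c d} → ChordsCross a b c d → ChordsCross a b d c
chordsCross-swapʳ {c = c} {d} = subst₂ (SortedChordsCross _ _) (⊓-comm c d) (⊔-comm c d)

separated⇒chordsCross : ∀ {a b x y} → CyclicallyOrdered a x b → CyclicallyOrdered b y a → ChordsCross a b x y
separated⇒chordsCross (inj₁ (a<x , x<b)) (inj₁ (b<y , y<a)) =
  contradiction (<-trans a<x x<b) (<-asym (<-trans b<y y<a))
separated⇒chordsCross (inj₁ (a<x , x<b)) (inj₂ (inj₁ (y<a , a<b))) =
  chordsCross-swapʳ (sortedChordsCross⇒chordsCross a<b (<-trans y<a a<x) (inj₂ (y<a , a<x , x<b)))
separated⇒chordsCross (inj₁ (a<x , x<b)) (inj₂ (inj₂ (a<b , b<y))) =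
  sortedChordsCross⇒chordsCross a<b (<-trans x<b b<y) (inj₁ (a<x , x<b , b<y))
separated⇒chordsCross (inj₂ (inj₁ (x<b , b<a))) (inj₁ (b<y , y<a)) =
  chordsCross-swapˡ (sortedChordsCross⇒chordsCross b<a (<-trans x<b b<y) (inj₂ (x<b , b<y , y<a)))
separated⇒chordsCross (inj₂ (inj₂ (b<a , a<x))) (inj₁ (b<y , y<a)) =
  chordsCross-swapˡ (chordsCross-swapʳ
    (sortedChordsCross⇒chordsCross b<a (<-trans y<a a<x) (inj₁ (b<y , y<a , a<x))))
separated⇒chordsCross (inj₂ (inj₁ (_ , b<a))) (inj₂ (inj₁ (_ , a<b))) = contradiction a<b (<-asym b<a)
separated⇒chordsCross (inj₂ (inj₁ (_ , b<a))) (inj₂ (inj₂ (a<b , _))) = contradiction a<b (<-asym b<a)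
separated⇒chordsCross (inj₂ (inj₂ (b<a , _))) (inj₂ (inj₁ (_ , a<b))) = contradiction a<b (<-asym b<a)
separated⇒chordsCross (inj₂ (inj₂ (b<a , _))) (inj₂ (inj₂ (a<b , _))) = contradiction a<b (<-asym b<a)

toℕ-≢ : ∀ {x y : Fin n} → x ≢ y → toℕ x ≢ toℕ y
toℕ-≢ x≢y = x≢y ∘ toℕ-injective

<⇒≤∸1 : ∀ {x} → x < n → x ≤ n ∸ 1
<⇒≤∸1 {n = suc _} = ≤-pred

standardOrder : CyclicOrder n
standardOrder = record
  { Btw        = λ x y z → CyclicallyOrdered (toℕ x) (toℕ y) (toℕ z)
  ; btw?       = λ x y z → cyclicallyOrdered? (toℕ x) (toℕ y) (toℕ z)
  ; btw-rotate = cyclic-rotate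
  ; btw-asym   = cyclic-asym
  ; btw-trans  = cyclic-trans
  ; btw-total  = λ x≢y y≢z x≢z → cyclic-total (toℕ-≢ x≢y) (toℕ-≢ y≢z) (toℕ-≢ x≢z)
  }

cycleSuccessor : (a : Fin n) → ∃ λ s → CycleAdj a s
cycleSuccessor {n} a with suc (toℕ a) <? n
... | yes 1+a<n = fromℕ< 1+a<n , inj₁ (toℕ-fromℕ< 1+a<n)
... | no 1+a≮n  = fromℕ< (≤-<-trans z≤n (toℕ<n a)) , inj₂ (a≡n∸1 , toℕ-fromℕ< _)
  where
  a≡n∸1 : toℕ a ≡ n ∸ 1
  a≡n∸1 = cong (_∸ 1) (≤-antisym (toℕ<n a) (≮⇒≥ 1+a≮n))

module _ {a s : Fin n} where
  open CyclicOrder (standardOrder {n})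

  cycleAdj-between : CycleAdj a s → ∀ {x b} → Btw a x b → Btw a s b
  cycleAdj-between (inj₁ s≡1+a) {b = b} axb =
    subst (λ t → CyclicallyOrdered (toℕ a) t (toℕ b)) (sym s≡1+a) (cyclic-suc axb)
  cycleAdj-between (inj₂ (a≡n∸1 , s≡0)) {x} {b} axb =
    subst (λ t → CyclicallyOrdered (toℕ a) t (toℕ b)) (sym s≡0)
          (cyclic-zero (subst (toℕ x ≤_) (sym a≡n∸1) (<⇒≤∸1 (toℕ<n x))) axb)

  cycleAdj-outside : CycleAdj a s → ∀ {x} → x ≢ a → x ≢ s → Btw s x a
  cycleAdj-outside (inj₁ s≡1+a) {x} x≢a x≢s =
    subst (λ t → CyclicallyOrdered t (toℕ x) (toℕ a)) (sym s≡1+a)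
          (cyclic-fromSuc (toℕ-≢ x≢a) (λ x≡1+a → toℕ-≢ x≢s (trans x≡1+a (sym s≡1+a))))
  cycleAdj-outside (inj₂ (a≡n∸1 , s≡0)) {x} x≢a x≢s =
    subst₂ (λ t r → CyclicallyOrdered t (toℕ x) r) (sym s≡0) (sym a≡n∸1)
           (cyclic-fromZero (<⇒≤∸1 (toℕ<n x))
                            (λ x≡n∸1 → toℕ-≢ x≢a (trans x≡n∸1 (sym a≡n∸1)))
                            (λ x≡0 → toℕ-≢ x≢s (trans x≡0 (sym s≡0))))

module _ {G : Graph n} (nt : OuterplanarNearTriangulation G) where
  open OuterplanarNearTriangulation nt
  open CyclicOrder (standardOrder {n})

  standard-nonCrossing : NonCrossing G standardOrder
  standard-nonCrossing {a} {b} {x} {y} ab xy axb bya = noCross a b x y ab xy (separated⇒chordsCross axb bya)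

  nonAdjacent-separated : ∀ {a b} → a ≢ b → adj G a b ≡ false →
                          ∃₂ λ c d → Adj G c d × Btw a c b × Btw b d a
  nonAdjacent-separated {a} {b} a≢b a≁b with triangles a b a≢b a≁b
  ... | c , d , cd , cross with chordsCross⇒separated (toℕ a) (toℕ b) (toℕ c) (toℕ d) cross
  ...   | inj₁ (acb , bda) = c , d , cd , acb , bda
  ...   | inj₂ (adb , bca) = d , c , adj-sym {G = G} cd , adb , bca

  cycleSuccessor-between : ∀ {a b x} → Btw a x b → ∃ λ s → Btw a s b × Adj G a s
  cycleSuccessor-between {a} axb =
    let s , a→s = cycleSuccessor a in s , cycleAdj-between a→s axb , cycle a s a→s

  standardOuterplanarOrder : OuterplanarOrder G
  standardOuterplanarOrder = record
    { cyclicOrder = standardOrder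
    ; nonCrossing = standard-nonCrossing
    ; triangular  = triangular-bySeparation {G = G} standardOrder standard-nonCrossing
                      nonAdjacent-separated cycleSuccessor-between
    }

  cycleEdge-spanning : ∀ {u v} → OnCycleEdge u v →
                       ∃ λ (O : OuterplanarOrder G) → Adj G u v × (∀ y → OuterplanarOrder.Closed O u v y)
  cycleEdge-spanning {u} {v} (inj₁ u→v) =
    reverse standardOuterplanarOrder , cycle u v u→v ,
    OuterplanarOrder.Closed-total (reverse standardOuterplanarOrder) (cycleAdj-outside u→v)
  cycleEdge-spanning {u} {v} (inj₂ v→u) =
    standardOuterplanarOrder , adj-sym {G = G} (cycle v u v→u) ,
    OuterplanarOrder.Closed-total standardOuterplanarOrder λ x≢u x≢v → cycleAdj-outside v→u x≢v x≢u

theorem4p1 : ∀ {n : ℕ} (G : Graph n) → OuterplanarNearTriangulation G →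
    (u v : Fin n) → OnCycleEdge u v →
    (𝓗 : Cover G) → TwoFold 𝓗 →
    (φ : PartialColoring 𝓗) → HasDomain₂ 𝓗 φ u v → PartialThreeDefective 𝓗 φ →
    ∃ λ (ψ : Coloring 𝓗) → Extends 𝓗 ψ φ × ThreeDefective 𝓗 ψ ×
      (∀ a b → φ u ≡ just a → φ v ≡ just b →
        (match 𝓗 u v a b ≡ true → def 𝓗 ψ u ≤ 1 × def 𝓗 ψ v ≤ 2) ×
        (match 𝓗 u v a b ≡ false → def 𝓗 ψ u ≤ 0 × def 𝓗 ψ v ≤ 1))
theorem4p1 G nt u v uv 𝓗 twoFold φ (_ , undefined) _ with cycleEdge-spanning nt uv
... | O , u∼v , spanning
    with ColoringExtension.extendEdgeColoring 𝓗 twoFold O u∼v spanning (ColoringExtension.completion 𝓗 twoFold φ)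
... | ψ , ψu , ψv , threeDefective , atU , atV =
  ψ , completion-extends ψ undefined ψu ψv , threeDefective , bounds
  where
  open ColoringExtension 𝓗 twoFold
  bounds : ∀ a b → φ u ≡ just a → φ v ≡ just b →
           (match 𝓗 u v a b ≡ true → def 𝓗 ψ u ≤ 1 × def 𝓗 ψ v ≤ 2) ×
           (match 𝓗 u v a b ≡ false → def 𝓗 ψ u ≤ 0 × def 𝓗 ψ v ≤ 1)
  bounds a b φu φv =
      (λ _ → ≤-trans atU (conflict≤1 _ u v) , ≤-trans atV (s≤s (conflict≤1 _ u v)))
    , λ unmatched → let uv≡0 = completion-conflict φ φu φv unmatched in
                    ≤-trans atU (≤-reflexive uv≡0) , ≤-trans atV (s≤s (≤-reflexive uv≡0))
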